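{- Let $G=(V,E)$ be an undirected graph, let $X$ be a $(d,\phi)$-well-linked set in $G$, let $p,x\in X$ be distinct with $\mathrm{mincut}_G(p,x)\le 2d$, and let $(A,B)$ be any $(p,x)$-mincut of $G$ with $p\in A$ and $x\in B$. Then $\min(|A\cap X|,|B\cap X|)\le\frac{2}{\phi}$.
   Context: $\mathrm{mincut}_G(u,v)$ (resp. $\mathrm{mincut}_G(A,B)$) is the minimum number of edges in a cut of $G$ separating $u$ from $v$ (resp. vertex set $A$ from $B$); a $(p,x)$-mincut is a partition $(A,B)$ of $V$ with $p\in A$, $x\in B$ and $|E(A,B)|=\mathrm{mincut}_G(p,x)$. A vertex set $X$ is $(d,\phi)$-well-linked in $G$ if $\deg_G(v)\ge d$ for every $v\in X$ and, for every partition $(A,B)$ of $X$, $\mathrm{mincut}_G(A,B)\ge\phi\, d\min\{|A|,|B|\}$. -}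

module Defs where

open import Data.Nat using (ℕ; zero; suc; _+_)
open import Data.Nat as ℕ using ()
open import Data.Bool using (Bool; true; false; if_then_else_; _xor_; _∨_)
open import Data.Fin using (Fin; _≟_)
open import Data.Fin.Subset using (Subset; _∈_; _∉_; _⊆_; ∁)
open import Data.Vec using (lookup)
open import Data.List using (List; map)
open import Data.Nat.ListAction using (sum)
open import Data.List.Relation.Unary.All using (All)
open import Data.Product using (_×_; _,_; proj₁; proj₂)
open import Data.Integer using (+_)
open import Data.Rational using (ℚ; _/_; _≤_)
open import Relation.Nullary using (¬_)
open import Relation.Nullary.Decidable using (⌊_⌋)
open import Relation.Binary.PropositionalEquality using (_≡_)

-- A finite undirected (multi)graph on vertex set Fin n, given by its list of
-- edges; each edge is an unordered pair {u,v} recorded as (u , v).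
-- No self-loops.
record Graph : Set where
  field
    n        : ℕ
    edges    : List (Fin n × Fin n)
    loopless : All (λ e → ¬ (proj₁ e ≡ proj₂ e)) edges
open Graph public

ℕ→ℚ : ℕ → ℚ
ℕ→ℚ k = + k / 1

deg : (G : Graph) → Fin (n G) → ℕ
deg G v = sum (map (λ e → if ⌊ proj₁ e ≟ v ⌋ ∨ ⌊ proj₂ e ≟ v ⌋ then 1 else 0) (edges G))

cutSize : (G : Graph) → Subset (n G) → ℕ
cutSize G S = sum (map (λ e → if lookup S (proj₁ e) xor lookup S (proj₂ e) then 1 else 0) (edges G))

Separates : (G : Graph) → Subset (n G) → Subset (n G) → Subset (n G) → Set
Separates G S A B = A ⊆ S × B ⊆ ∁ S

SeparatesV : (G : Graph) → Subset (n G) → Fin (n G) → Fin (n G) → Set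
SeparatesV G S u v = u ∈ S × v ∉ S

MincutGe : (G : Graph) → Subset (n G) → Subset (n G) → ℚ → Set
MincutGe G A B t = ∀ S → Separates G S A B → t ≤ ℕ→ℚ (cutSize G S)

MincutVLe : (G : Graph) → Fin (n G) → Fin (n G) → ℚ → Set
MincutVLe G u v t = Data.Product.Σ (Subset (n G)) (λ S → SeparatesV G S u v × ℕ→ℚ (cutSize G S) ≤ t)

IsMincut : (G : Graph) → Fin (n G) → Fin (n G) → Subset (n G) → Set
IsMincut G p x S = SeparatesV G S p x × (∀ S' → SeparatesV G S' p x → cutSize G S ℕ.≤ cutSize G S')

-- X is (d,φ)-well-linked in G.  A partition (A,B) of X is given as
-- A = T ∩ X, B = (V∖T) ∩ X for an arbitrary T ⊆ V (this yields every partition).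
WellLinked : (G : Graph) → Subset (n G) → ℚ → ℚ → Set
WellLinked G X d φ =
  (∀ v → v ∈ X → d ≤ ℕ→ℚ (deg G v)) ×
  (∀ T → MincutGe G (T ∩ X) (∁ T ∩ X)
           (φ * d * ℕ→ℚ (ℕ._⊓_ ∣ T ∩ X ∣ ∣ ∁ T ∩ X ∣)))
  where
  open Data.Fin.Subset using (_∩_; ∣_∣)
  open Data.Rational using (_*_)

{-# OPTIONS --safe #-}
module Submission where

-- Proof idea: a (p,x)-mincut (S, V∖S) also separates S ∩ X from ∁ S ∩ X, so
-- well-linkedness bounds its size below by φ·d·min(|S ∩ X|, |∁ S ∩ X|), while
-- minimality bounds it above by mincut(p,x) ≤ 2d. Dividing by φ·d > 0 gives the
-- claim.

open import Defs
open import Data.Nat as ℕ using ()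
open import Data.Fin using (Fin)
open import Data.Fin.Subset using (Subset; _∈_; _∩_; ∁; ∣_∣)
open import Data.Rational using (ℚ; Positive; _≤_; _*_; _÷_; 1ℚ; _+_; mkℚ; *≤*; 1/_)
open import Data.Rational.Properties using (pos⇒nonZero)
open import Relation.Nullary using (¬_)
open import Relation.Binary.PropositionalEquality using (_≡_; sym; cong; subst; subst₂; module ≡-Reasoning)
open import Data.Product using (_,_)
import Data.Rational.Properties as ℚ
import Data.Integer as ℤ
import Data.Integer.Properties as ℤ
import Data.Nat.Coprimality as Coprimality
import Data.Fin.Subset.Properties as Subset

ℕ→ℚ≡mkℚ : ∀ k → ℕ→ℚ k ≡ mkℚ (ℤ.+ k) 0 (Coprimality.sym (Coprimality.1-coprimeTo k))
ℕ→ℚ≡mkℚ k = ℚ.normalize-coprime (Coprimality.sym (Coprimality.1-coprimeTo k))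

ℕ→ℚ-mono-≤ : ∀ {a b} → a ℕ.≤ b → ℕ→ℚ a ≤ ℕ→ℚ b
ℕ→ℚ-mono-≤ {a} {b} a≤b rewrite ℕ→ℚ≡mkℚ a | ℕ→ℚ≡mkℚ b =
  *≤* (ℤ.*-monoʳ-≤-nonNeg (ℤ.+ 1) (ℤ.+≤+ a≤b))

φ*d*m≤c*d⇒m≤c÷φ : ∀ φ d c {m} .{{_ : Positive φ}} .{{_ : Positive d}} →
                  φ * d * m ≤ c * d → m ≤ _÷_ c φ {{pos⇒nonZero φ}}
φ*d*m≤c*d⇒m≤c÷φ φ d c {m} φdm≤cd =
  ℚ.*-cancelʳ-≤-pos φ (subst₂ _≤_ (ℚ.*-comm φ m) (sym c÷φ*φ≡c) φm≤c)
  where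
  open ≡-Reasoning
  instance
    _ = pos⇒nonZero φ
  φm≤c : φ * m ≤ c
  φm≤c = ℚ.*-cancelʳ-≤-pos d (subst (_≤ c * d) φdm≡φmd φdm≤cd)
    where
    φdm≡φmd : φ * d * m ≡ φ * m * d
    φdm≡φmd = begin
      φ * d * m   ≡⟨ ℚ.*-assoc φ d m ⟩
      φ * (d * m) ≡⟨ cong (φ *_) (ℚ.*-comm d m) ⟩
      φ * (m * d) ≡⟨ sym (ℚ.*-assoc φ m d) ⟩
      φ * m * d   ∎
  c÷φ*φ≡c : (c ÷ φ) * φ ≡ c
  c÷φ*φ≡c = begin
    c * (1/ φ) * φ   ≡⟨ ℚ.*-assoc c (1/ φ) φ ⟩
    c * ((1/ φ) * φ) ≡⟨ cong (c *_) (ℚ.*-inverseˡ φ) ⟩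
    c * 1ℚ           ≡⟨ ℚ.*-identityʳ c ⟩
    c                ∎

separates-sides : ∀ G S X → Separates G S (S ∩ X) (∁ S ∩ X)
separates-sides G S X = Subset.p∩q⊆p S X , Subset.p∩q⊆p (∁ S) X

mincut-cutSize≤ : ∀ G {p x S t} → IsMincut G p x S → MincutVLe G p x t →
                  ℕ→ℚ (cutSize G S) ≤ t
mincut-cutSize≤ G (_ , minimal) (S′ , separates , size≤t) =
  ℚ.≤-trans (ℕ→ℚ-mono-≤ (minimal S′ separates)) size≤t

proposition3p7 : (G : Graph) (X : Subset (n G)) (d φ : ℚ) → .{{_ : Positive d}} → .{{_ : Positive φ}} →
    WellLinked G X d φ →
    (p x : Fin (n G)) → p ∈ X → x ∈ X → ¬ (p ≡ x) →
    MincutVLe G p x ((1ℚ + 1ℚ) * d) →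
    (S : Subset (n G)) → IsMincut G p x S →
    ℕ→ℚ (ℕ._⊓_ ∣ S ∩ X ∣ ∣ ∁ S ∩ X ∣) ≤ _÷_ (1ℚ + 1ℚ) φ {{pos⇒nonZero φ}}
proposition3p7 G X d φ (_ , cutsLarge) p x _ _ _ mincut≤2d S isMincut =
  φ*d*m≤c*d⇒m≤c÷φ φ d (1ℚ + 1ℚ) (ℚ.≤-trans (cutsLarge S S (separates-sides G S X))
                                            (mincut-cutSize≤ G isMincut mincut≤2d))
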